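{- Let $\pi\in S_n$ avoid $1432$. Then the Rothe diagram $R(\pi)$ satisfies: (a) every connected component of $R(\pi)$ other than the dominant region is a rectangle $\{a,\dots,b\}\times\{c,\dots,d\}$; (b) if $B_1\neq B_2$ are two connected components of $R(\pi)$, neither of which is the dominant region, with essential boxes $(i_1,j_1)\in B_1$ and $(i_2,j_2)\in B_2$, then: if $B_1$ and $B_2$ both contain cells in some common row $r$, then $i_1=i_2$; and if $B_1$ and $B_2$ both contain cells in some common column, then $j_1=j_2$.
   Context: $\pi$ avoids $1432$ if there are no indices $a<b<c<d$ with $\pi(a)<\pi(d)<\pi(c)<\pi(b)$. The Rothe diagram of $\pi$ is $R(\pi)=\{(i,j)\in[n]^2:\ \pi(i)>j,\ \pi^{ -1}(j)>i\}$ (the blank tiles of the bumpless pipe dream of the permutation matrix of $\pi$; $i$ is the row index, $j$ the column index). Connected components are taken with respect to adjacency of cells sharing an edge; each component is a (top-left justified) partition shape. The dominant region is the component containing $(1,1)$ (empty if $(1,1)\notin R(\pi)$). An essential box is a cell $(i,j)\in R(\pi)$ with $(i+1,j)\notin R(\pi)$ and $(i,j+1)\notin R(\pi)$, i.e. a south-east-most corner of a component; a rectangular component has exactly one essential box. -}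

module Defs where

open import Data.Nat using (ℕ; zero; suc)
open import Data.Fin using (Fin; toℕ; _<_; _≤_)
open import Data.Fin.Permutation using (Permutation′; _⟨$⟩ʳ_; _⟨$⟩ˡ_)
open import Data.Product using (_×_; Σ; ∃; _,_)
open import Data.Sum using (_⊎_)
open import Relation.Nullary using (¬_)
open import Relation.Binary.PropositionalEquality using (_≡_)

-- Rows and columns are indexed by Fin n (0-based: row/column k ↔ paper's k+1).
-- A cell is a pair (row , column).
Cell : ℕ → Set
Cell n = Fin n × Fin n

row : ∀ {n} → Cell n → Fin n
row (i , _) = i

col : ∀ {n} → Cell n → Fin n
col (_ , j) = j

Avoids1432 : ∀ {n} → Permutation′ n → Set
Avoids1432 {n} π =
  ¬ (Σ (Fin n) λ a → Σ (Fin n) λ b → Σ (Fin n) λ c → Σ (Fin n) λ d →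
       (a < b) × (b < c) × (c < d) ×
       ((π ⟨$⟩ʳ a) < (π ⟨$⟩ʳ d)) × ((π ⟨$⟩ʳ d) < (π ⟨$⟩ʳ c)) × ((π ⟨$⟩ʳ c) < (π ⟨$⟩ʳ b)))

InRothe : ∀ {n} → Permutation′ n → Cell n → Set
InRothe π (i , j) = (j < (π ⟨$⟩ʳ i)) × (i < (π ⟨$⟩ˡ j))

Consecutive : ∀ {n} → Fin n → Fin n → Set
Consecutive k k' = (suc (toℕ k) ≡ toℕ k') ⊎ (suc (toℕ k') ≡ toℕ k)

Adjacent : ∀ {n} → Cell n → Cell n → Set
Adjacent (i , j) (i' , j') = ((i ≡ i') × Consecutive j j') ⊎ ((j ≡ j') × Consecutive i i')

data Connected {n} (π : Permutation′ n) : Cell n → Cell n → Set where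
  here : ∀ {p} → InRothe π p → Connected π p p
  step : ∀ {p q r} → Connected π p q → Adjacent q r → InRothe π r → Connected π p r

-- p ∈ R(π) and the component of p is not the dominant region
-- (the dominant region is the component of the cell (1,1), i.e. index (0,0);
-- it is empty if (1,1) ∉ R(π)).
NonDominant : ∀ {n} → Permutation′ n → Cell n → Set
NonDominant {n} π p =
  InRothe π p ×
  (∀ (o : Cell n) → toℕ (row o) ≡ 0 → toℕ (col o) ≡ 0 → ¬ Connected π o p)

-- Essential box: (i,j) ∈ R(π), (i+1,j) ∉ R(π), (i,j+1) ∉ R(π)
-- (cells outside the n×n grid are not in R(π)).
Essential : ∀ {n} → Permutation′ n → Cell n → Set
Essential {n} π (i , j) =
  InRothe π (i , j) ×
  (∀ (i' : Fin n) → toℕ i' ≡ suc (toℕ i) → ¬ InRothe π (i' , j)) ×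
  (∀ (j' : Fin n) → toℕ j' ≡ suc (toℕ j) → ¬ InRothe π (i , j'))

ComponentIsRectangle : ∀ {n} → Permutation′ n → Cell n → Set
ComponentIsRectangle {n} π p =
  Σ (Fin n) λ a → Σ (Fin n) λ b → Σ (Fin n) λ c → Σ (Fin n) λ d →
    (a ≤ b) × (c ≤ d) ×
    (∀ (q : Cell n) →
       (Connected π p q → (a ≤ row q) × (row q ≤ b) × (c ≤ col q) × (col q ≤ d)) ×
       ((a ≤ row q) × (row q ≤ b) × (c ≤ col q) × (col q ≤ d) → Connected π p q))

{-# OPTIONS --safe #-}
-- Call a Rothe cell shadowed if some dot of π lies strictly north-west of it; the unshadowed
-- Rothe cells are exactly the dominant region.  Shadowed cells are closed under four local
-- moves on 2 × 2 squares: three hold in every Rothe diagram, and the fourth, completing an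
-- L-shape to a square, is where 1432-avoidance enters.  Closure under these moves forces the
-- component of any shadowed cell to be a full rectangle whose four bordering lines contain no
-- shadowed cell, and a component outside the dominant region consists of shadowed cells only.
-- For (b), the essential box of such a rectangle is its south-east corner.  If two rectangles
-- share a row but their bottom rows satisfy b₁ < b₂, the second one meets row b₁ + 1; yet
-- avoidance makes every Rothe cell in the row just below an essential box unshadowed.  Columns
-- follow by passing to π⁻¹, which avoids 1432 and whose Rothe diagram is the transpose.
module Submission where

open import Defs
open import Data.Nat using (ℕ; zero; suc; _+_; _≤_; _<_; z≤n)
open import Data.Nat.Properties
open import Data.Fin using (Fin; toℕ; fromℕ<)
open import Data.Fin.Properties using (toℕ-injective; toℕ<n; toℕ-fromℕ<; any?)
  renaming (≤∧≢⇒< to ≤∧≢⇒<ᶠ)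
open import Data.Fin.Permutation using (Permutation′; _⟨$⟩ʳ_; _⟨$⟩ˡ_; inverseʳ; inverseˡ; flip)
open import Data.Product using (Σ; ∃; _×_; _,_; proj₁; proj₂; swap)
open import Data.Sum using (inj₁; inj₂)
open import Data.Empty using (⊥; ⊥-elim)
open import Function using (id; _∘_)
open import Relation.Nullary using (¬_; Dec; yes; no)
open import Relation.Nullary.Decidable using (_×-dec_)
open import Relation.Binary.Definitions using (tri<; tri≈; tri>)
open import Relation.Binary.PropositionalEquality using (_≡_; _≢_; refl; sym; trans; cong; subst; subst₂)

spread-up : (P : ℕ → Set) {j d : ℕ} → P j →
  (∀ s → j ≤ s → s < d → P s → P (suc s)) →
  ∀ s → j ≤ s → s ≤ d → P s
spread-up P Pj up zero j≤0 _ = subst P (n≤0⇒n≡0 j≤0) Pj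
spread-up P Pj up (suc s) j≤1+s 1+s≤d with m≤n⇒m<n∨m≡n j≤1+s
... | inj₂ refl = Pj
... | inj₁ j<1+s = up s (≤-pred j<1+s) 1+s≤d
  (spread-up P Pj up s (≤-pred j<1+s) (≤-trans (n≤1+n s) 1+s≤d))

spread-down : (P : ℕ → Set) {c j : ℕ} → P j →
  (∀ s → c ≤ s → s < j → P (suc s) → P s) →
  ∀ s → c ≤ s → s ≤ j → P s
spread-down P {j = zero} P0 down s _ s≤0 = subst P (sym (n≤0⇒n≡0 s≤0)) P0
spread-down P {j = suc j} Pj down s c≤s s≤1+j with m≤n⇒m<n∨m≡n s≤1+j
... | inj₂ refl = Pj
... | inj₁ s<1+j = spread-down P (down j (≤-trans c≤s (≤-pred s<1+j)) (n<1+n j) Pj)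
  (λ t c≤t t<j → down t c≤t (≤-trans t<j (n≤1+n j))) s c≤s (≤-pred s<1+j)

spread : (P : ℕ → Set) {c j d : ℕ} → P j →
  (∀ s → j ≤ s → s < d → P s → P (suc s)) →
  (∀ s → c ≤ s → s < j → P (suc s) → P s) →
  ∀ s → c ≤ s → s ≤ d → P s
spread P {j = j} Pj up down s c≤s s≤d with ≤-total j s
... | inj₁ j≤s = spread-up P Pj up s j≤s s≤d
... | inj₂ s≤j = spread-down P Pj down s c≤s s≤j

funnel : (P : ℕ → Set) {c j d : ℕ} →
  (∀ s → c ≤ s → s < j → P s → P (suc s)) →
  (∀ s → j ≤ s → s < d → P (suc s) → P s) →
  ∀ s → c ≤ s → s ≤ d → P s → P j
funnel P {j = j} up down = spread (λ s → P s → P j) id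
  (λ s j≤s s<d Ps⇒Pj → Ps⇒Pj ∘ down s j≤s s<d)
  (λ s c≤s s<j P1+s⇒Pj → P1+s⇒Pj ∘ up s c≤s s<j)

record MaximalRun (P : ℕ → Set) (i : ℕ) : Set where
  field
    start end : ℕ
    start≤i : start ≤ i
    i≤end : i ≤ end
    inside : ∀ r → start ≤ r → r ≤ end → P r
    ¬after : ¬ P (suc end)
    ¬before : ∀ r → suc r ≡ start → ¬ P r

module _ (P : ℕ → Set) (P? : ∀ r → Dec (P r)) where

  run-end : ∀ fuel {N} i → (∀ r → P r → r < N) → N ≤ fuel + i → P i →
    Σ ℕ λ end → i ≤ end × (∀ r → i ≤ r → r ≤ end → P r) × ¬ P (suc end)
  run-end zero i bound N≤i Pi = ⊥-elim (<⇒≱ (bound i Pi) N≤i)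
  run-end (suc fuel) {N} i bound N≤ Pi with P? (suc i)
  ... | no ¬P1+i = i , ≤-refl , (λ r i≤r r≤i → subst P (≤-antisym i≤r r≤i) Pi) , ¬P1+i
  ... | yes P1+i with run-end fuel (suc i) bound (subst (N ≤_) (sym (+-suc fuel i)) N≤) P1+i
  ... | end , 1+i≤end , inside , ¬after = end , ≤-trans (n≤1+n i) 1+i≤end , inside′ , ¬after
    where
    inside′ : ∀ r → i ≤ r → r ≤ end → P r
    inside′ r i≤r r≤end with m≤n⇒m<n∨m≡n i≤r
    ... | inj₁ i<r = inside r i<r r≤end
    ... | inj₂ refl = Pi

  run-start : ∀ i → P i →
    Σ ℕ λ start → start ≤ i × (∀ r → start ≤ r → r ≤ i → P r) × (∀ r → suc r ≡ start → ¬ P r)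
  run-start zero P0 = zero , z≤n , (λ r _ r≤0 → subst P (sym (n≤0⇒n≡0 r≤0)) P0) , λ _ ()
  run-start (suc i) P1+i with P? i
  ... | no ¬Pi = suc i , ≤-refl , (λ r i≤r r≤i → subst P (≤-antisym i≤r r≤i) P1+i) ,
                 λ { r refl → ¬Pi }
  ... | yes Pi with run-start i Pi
  ... | start , start≤i , inside , ¬before = start , ≤-trans start≤i (n≤1+n i) , inside′ , ¬before
    where
    inside′ : ∀ r → start ≤ r → r ≤ suc i → P r
    inside′ r start≤r r≤1+i with m≤n⇒m<n∨m≡n r≤1+i
    ... | inj₁ r<1+i = inside r start≤r (≤-pred r<1+i)
    ... | inj₂ refl = P1+i

  maximal-run : ∀ N → (∀ r → P r → r < N) → ∀ i → P i → MaximalRun P i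
  maximal-run N bound i Pi = record
    { start = start ; end = end ; start≤i = start≤i ; i≤end = i≤end
    ; inside = inside ; ¬after = ¬after ; ¬before = ¬before }
    where
    lower = run-start i Pi
    upper = run-end N i bound (m≤m+n N i) Pi
    start = proj₁ lower
    start≤i = proj₁ (proj₂ lower)
    ¬before = proj₂ (proj₂ (proj₂ lower))
    end = proj₁ upper
    i≤end = proj₁ (proj₂ upper)
    ¬after = proj₂ (proj₂ (proj₂ upper))
    inside : ∀ r → start ≤ r → r ≤ end → P r
    inside r start≤r r≤end with ≤-total r i
    ... | inj₁ r≤i = proj₁ (proj₂ (proj₂ lower)) r start≤r r≤i
    ... | inj₂ i≤r = proj₁ (proj₂ (proj₂ upper)) r i≤r r≤end

_ᵀ : (ℕ → ℕ → Set) → ℕ → ℕ → Set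
(S ᵀ) r s = S s r

-- nw, ne, sw and se are the four cells of the 2 × 2 square with north-west corner (r , s).
record GridRules (S : ℕ → ℕ → Set) : Set where
  field
    S? : ∀ r s → Dec (S r s)
    bound : ℕ
    row<bound : ∀ {r s} → S r s → r < bound
    col<bound : ∀ {r s} → S r s → s < bound
    nw,se⇒ne : ∀ {r s} → S r s → S (suc r) (suc s) → S r (suc s)
    nw,se⇒sw : ∀ {r s} → S r s → S (suc r) (suc s) → S (suc r) s
    ne,sw⇒nw : ∀ {r s} → S r (suc s) → S (suc r) s → S r s
    nw,ne,sw⇒se : ∀ {r s} → S r s → S r (suc s) → S (suc r) s → S (suc r) (suc s)

transpose : ∀ {S} → GridRules S → GridRules (S ᵀ)
transpose G = record
  { S? = λ r s → S? s r ; bound = bound ; row<bound = col<bound ; col<bound = row<bound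
  ; nw,se⇒ne = nw,se⇒sw ; nw,se⇒sw = nw,se⇒ne
  ; ne,sw⇒nw = λ ne sw → ne,sw⇒nw sw ne
  ; nw,ne,sw⇒se = λ nw ne sw → nw,ne,sw⇒se nw sw ne }
  where open GridRules G

record Box (S : ℕ → ℕ → Set) (i j : ℕ) : Set where
  field
    a b c d : ℕ
    a≤i : a ≤ i
    i≤b : i ≤ b
    c≤j : c ≤ j
    j≤d : j ≤ d
    filled : ∀ r s → a ≤ r → r ≤ b → c ≤ s → s ≤ d → S r s
    ¬below : ∀ s → c ≤ s → s ≤ d → ¬ S (suc b) s
    ¬above : ∀ r → suc r ≡ a → ∀ s → c ≤ s → s ≤ d → ¬ S r s
    ¬right : ∀ r → a ≤ r → r ≤ b → ¬ S r (suc d)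
    ¬left : ∀ s → suc s ≡ c → ∀ r → a ≤ r → r ≤ b → ¬ S r s

module BoxConstruction {S : ℕ → ℕ → Set} (G : GridRules S) {i j : ℕ} (Sij : S i j) where
  open GridRules G

  rows : MaximalRun (λ r → S r j) i
  rows = maximal-run (λ r → S r j) (λ r → S? r j) bound (λ r → row<bound) i Sij

  cols : MaximalRun (λ s → S i s) j
  cols = maximal-run (λ s → S i s) (λ s → S? i s) bound (λ s → col<bound) j Sij

  open MaximalRun rows public using () renaming (start to a; end to b; start≤i to a≤i; i≤end to i≤b)
  open MaximalRun cols public using () renaming (start to c; end to d; start≤i to c≤j; i≤end to j≤d)

  RowFilled : ℕ → Set
  RowFilled r = ∀ s → c ≤ s → s ≤ d → S r s

  fill-up : ∀ r → i ≤ r → r < b → RowFilled r → RowFilled (suc r)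
  fill-up r i≤r r<b Fr = spread (S (suc r))
    (MaximalRun.inside rows (suc r) (≤-trans a≤i (≤-trans i≤r (n≤1+n r))) r<b)
    (λ s j≤s s<d → nw,ne,sw⇒se (Fr s (≤-trans c≤j j≤s) (<⇒≤ s<d))
                                 (Fr (suc s) (≤-trans c≤j (≤-trans j≤s (n≤1+n s))) s<d))
    (λ s c≤s s<j → nw,se⇒sw (Fr s c≤s (≤-trans (<⇒≤ s<j) j≤d)))

  fill-down : ∀ r → a ≤ r → r < i → RowFilled (suc r) → RowFilled r
  fill-down r a≤r r<i F1+r = spread (S r)
    (MaximalRun.inside rows r a≤r (≤-trans (<⇒≤ r<i) i≤b))
    (λ s j≤s s<d Srs → nw,se⇒ne Srs (F1+r (suc s) (≤-trans c≤j (≤-trans j≤s (n≤1+n s))) s<d))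
    (λ s c≤s s<j Sr1+s → ne,sw⇒nw Sr1+s (F1+r s c≤s (≤-trans (<⇒≤ s<j) j≤d)))

  filled : ∀ r s → a ≤ r → r ≤ b → c ≤ s → s ≤ d → S r s
  filled r s a≤r r≤b = spread RowFilled (MaximalRun.inside cols) fill-up fill-down r a≤r r≤b s

  ¬below : ∀ s → c ≤ s → s ≤ d → ¬ S (suc b) s
  ¬below s c≤s s≤d S1+b,s = MaximalRun.¬after rows (funnel (S (suc b))
    (λ s c≤s s<j → nw,ne,sw⇒se (bottom s c≤s (≤-trans (<⇒≤ s<j) j≤d))
                                 (bottom (suc s) (≤-trans c≤s (n≤1+n s)) (≤-trans s<j j≤d)))
    (λ s j≤s s<d → nw,se⇒sw (bottom s (≤-trans c≤j j≤s) (<⇒≤ s<d)))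
    s c≤s s≤d S1+b,s)
    where
    bottom : ∀ s → c ≤ s → s ≤ d → S b s
    bottom s = filled b s (≤-trans a≤i i≤b) ≤-refl

  ¬above : ∀ r → suc r ≡ a → ∀ s → c ≤ s → s ≤ d → ¬ S r s
  ¬above r 1+r≡a s c≤s s≤d Srs = MaximalRun.¬before rows r 1+r≡a (funnel (S r)
    (λ s c≤s s<j Srs → nw,se⇒ne Srs (top (suc s) (≤-trans c≤s (n≤1+n s)) (≤-trans s<j j≤d)))
    (λ s j≤s s<d Sr1+s → ne,sw⇒nw Sr1+s (top s (≤-trans c≤j j≤s) (<⇒≤ s<d)))
    s c≤s s≤d Srs)
    where
    top : ∀ s → c ≤ s → s ≤ d → S (suc r) s
    top s c≤s s≤d = subst (λ t → S t s) (sym 1+r≡a) (filled a s ≤-refl (≤-trans a≤i i≤b) c≤s s≤d)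

-- The transposed construction builds the same rectangle with rows and columns exchanged,
-- so its bottom and top edges are our right and left ones.
box : ∀ {S i j} → GridRules S → S i j → Box S i j
box G Sij = record
  { a = a ; b = b ; c = c ; d = d ; a≤i = a≤i ; i≤b = i≤b ; c≤j = c≤j ; j≤d = j≤d
  ; filled = filled ; ¬below = ¬below ; ¬above = ¬above
  ; ¬right = Transposed.¬below ; ¬left = Transposed.¬above }
  where
  open BoxConstruction G Sij
  module Transposed = BoxConstruction (transpose G) Sij

module _ {S : ℕ → ℕ → Set} {i j : ℕ} (B : Box S i j) where
  open Box B

  below-stays : ∀ {r r′ s} → r′ ≡ suc r → r ≤ b → c ≤ s → s ≤ d → S r′ s → r′ ≤ b
  below-stays {r} refl r≤b c≤s s≤d S1+r,s with m≤n⇒m<n∨m≡n r≤b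
  ... | inj₁ r<b = r<b
  ... | inj₂ refl = ⊥-elim (¬below _ c≤s s≤d S1+r,s)

  above-stays : ∀ {r r′ s} → suc r′ ≡ r → a ≤ r → c ≤ s → s ≤ d → S r′ s → a ≤ r′
  above-stays refl a≤r c≤s s≤d Sr′s with m≤n⇒m<n∨m≡n a≤r
  ... | inj₁ a<r = ≤-pred a<r
  ... | inj₂ a≡r = ⊥-elim (¬above _ (sym a≡r) _ c≤s s≤d Sr′s)

  right-stays : ∀ {r s s′} → s′ ≡ suc s → a ≤ r → r ≤ b → s ≤ d → S r s′ → s′ ≤ d
  right-stays {s = s} refl a≤r r≤b s≤d Srs′ with m≤n⇒m<n∨m≡n s≤d
  ... | inj₁ s<d = s<d
  ... | inj₂ refl = ⊥-elim (¬right _ a≤r r≤b Srs′)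

  left-stays : ∀ {r s s′} → suc s′ ≡ s → a ≤ r → r ≤ b → c ≤ s → S r s′ → c ≤ s′
  left-stays refl a≤r r≤b c≤s Srs′ with m≤n⇒m<n∨m≡n c≤s
  ... | inj₁ c<s = ≤-pred c<s
  ... | inj₂ c≡s = ⊥-elim (¬left _ (sym c≡s) _ a≤r r≤b Srs′)

module Rothe {n : ℕ} (π : Permutation′ n) where

  private
    P Q : Fin n → Fin n
    P = π ⟨$⟩ʳ_
    Q = π ⟨$⟩ˡ_

  P≢ : ∀ {i j} → toℕ i < toℕ (Q j) → P i ≢ j
  P≢ i<Qj refl = <-irrefl (cong toℕ (sym (inverseˡ π))) i<Qj

  Q≢ : ∀ {i j} → toℕ j < toℕ (P i) → Q j ≢ i
  Q≢ j<Pi refl = <-irrefl (cong toℕ (sym (inverseʳ π))) j<Pi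

  P-of : ∀ {i j} → Q j ≡ i → P i ≡ j
  P-of refl = inverseʳ π

  no-1432-through-column : Avoids1432 π → ∀ {a b c l} →
    toℕ a < toℕ b → toℕ b < toℕ c → toℕ c < toℕ (Q l) →
    toℕ (P a) < toℕ l → toℕ l < toℕ (P c) → toℕ (P c) < toℕ (P b) → ⊥
  no-1432-through-column avoids {a} {b} {c} {l} a<b b<c c<Ql Pa<l l<Pc Pc<Pb =
    avoids (a , b , c , Q l , a<b , b<c , c<Ql ,
            subst (λ x → toℕ (P a) < toℕ x) (sym (inverseʳ π)) Pa<l ,
            subst (λ x → toℕ x < toℕ (P c)) (sym (inverseʳ π)) l<Pc , Pc<Pb)

  -- Rothe cells with no dot of π north-west of them form the dominant region.
  DotNW : Cell n → Set
  DotNW (i , j) = ∃ λ k → toℕ k < toℕ i × toℕ (P k) < toℕ j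

  DotNW-mono : ∀ {i j i′ j′} → DotNW (i , j) → toℕ i ≤ toℕ i′ → toℕ j ≤ toℕ j′ → DotNW (i′ , j′)
  DotNW-mono (k , k<i , Pk<j) i≤i′ j≤j′ = k , <-≤-trans k<i i≤i′ , <-≤-trans Pk<j j≤j′

  module NextRow {i i′ : Fin n} (i+1 : toℕ i′ ≡ suc (toℕ i)) where

    i<i′ : toℕ i < toℕ i′
    i<i′ = ≤-reflexive (sym i+1)

    i′≤ : ∀ {k} → toℕ i < k → toℕ i′ ≤ k
    i′≤ = ≤-trans (≤-reflexive i+1)

    DotNW-up : ∀ {j} → toℕ j < toℕ (P i) → DotNW (i′ , j) → DotNW (i , j)
    DotNW-up j<Pi (k , k<i′ , Pk<j) =
      k , ≤∧≢⇒<ᶠ (≤-pred (≤-trans k<i′ (≤-reflexive i+1))) (λ { refl → <-asym Pk<j j<Pi }) , Pk<j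

    P≤-under-bottom-edge : ∀ {j} → InRothe π (i , j) → ¬ InRothe π (i′ , j) → toℕ (P i′) ≤ toℕ j
    P≤-under-bottom-edge (_ , i<Qj) ¬Ri′j =
      ≮⇒≥ λ j<Pi′ → ¬Ri′j (j<Pi′ , ≤∧≢⇒<ᶠ (i′≤ i<Qj) (Q≢ j<Pi′ ∘ sym))

    -- Here π(i′) ≤ j, so a dot k north-west of (i′ , s) would form a 1432 with rows i and i′
    -- and the dot in column s.
    row-under-bottom-edge-dominant : Avoids1432 π → ∀ {j s} →
      InRothe π (i , j) → ¬ InRothe π (i′ , j) → InRothe π (i′ , s) → ¬ DotNW (i′ , s)
    row-under-bottom-edge-dominant avoids {s = s} Rij@(j<Pi , _) ¬Ri′j (s<Pi′ , i′<Qs) dot =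
      no-pattern (DotNW-up (<-≤-trans s<Pi′ (≤-trans Pi′≤j (<⇒≤ j<Pi))) dot)
      where
      Pi′≤j = P≤-under-bottom-edge Rij ¬Ri′j
      no-pattern : ¬ DotNW (i , s)
      no-pattern (k , k<i , Pk<s) =
        no-1432-through-column avoids k<i i<i′ i′<Qs Pk<s s<Pi′ (≤-<-trans Pi′≤j j<Pi)

  module UnitSquare {i i′ j j′ : Fin n} (i+1 : toℕ i′ ≡ suc (toℕ i)) (j+1 : toℕ j′ ≡ suc (toℕ j)) where
    open NextRow i+1

    j<j′ : toℕ j < toℕ j′
    j<j′ = ≤-reflexive (sym j+1)

    j′≤ : ∀ {k} → toℕ j < k → toℕ j′ ≤ k
    j′≤ = ≤-trans (≤-reflexive j+1)

    nw,se⇒ne : InRothe π (i , j) → InRothe π (i′ , j′) → InRothe π (i , j′)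
    nw,se⇒ne (j<Pi , _) (_ , i′<Qj′) = ≤∧≢⇒<ᶠ (j′≤ j<Pi) (P≢ i<Qj′ ∘ sym) , i<Qj′
      where i<Qj′ = <-trans i<i′ i′<Qj′

    nw,se⇒sw : InRothe π (i , j) → InRothe π (i′ , j′) → InRothe π (i′ , j)
    nw,se⇒sw (_ , i<Qj) (j′<Pi′ , _) = j<Pi′ , ≤∧≢⇒<ᶠ (i′≤ i<Qj) (Q≢ j<Pi′ ∘ sym)
      where j<Pi′ = <-trans j<j′ j′<Pi′

    ne,sw⇒nw : InRothe π (i , j′) → InRothe π (i′ , j) → InRothe π (i , j)
    ne,sw⇒nw (j′<Pi , _) (_ , i′<Qj) = <-trans j<j′ j′<Pi , <-trans i<i′ i′<Qj

    -- If π(i′) = j′, the dot k, rows i and i′, and the dot in column j form a 1432.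
    nw,ne,sw⇒se : Avoids1432 π →
      InRothe π (i , j′) → InRothe π (i′ , j) → DotNW (i , j) → InRothe π (i′ , j′)
    nw,ne,sw⇒se avoids (j′<Pi , i<Qj′) (j<Pi′ , i′<Qj) (k , k<i , Pk<j) =
      ≤∧≢⇒<ᶠ (j′≤ j<Pi′) (Pi′≢j′ ∘ sym) , ≤∧≢⇒<ᶠ (i′≤ i<Qj′) (Pi′≢j′ ∘ P-of ∘ sym)
      where
      Pi′≢j′ : P i′ ≢ j′
      Pi′≢j′ Pi′≡j′ = no-1432-through-column avoids k<i i<i′ i′<Qj Pk<j j<Pi′
        (subst (λ x → toℕ x < toℕ (P i)) (sym Pi′≡j′) j′<Pi)

  dominant-quadrant : ∀ {i j r s} → InRothe π (i , j) → ¬ DotNW (i , j) →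
    toℕ r ≤ toℕ i → toℕ s ≤ toℕ j → InRothe π (r , s)
  dominant-quadrant {i} {j} {r} {s} (j<Pi , i<Qj) ¬dot r≤i s≤j = ≤-<-trans s≤j j<Pr , ≤-<-trans r≤i i<Qs
    where
    j<Pr : toℕ j < toℕ (P r)
    j<Pr with m≤n⇒m<n∨m≡n r≤i
    ... | inj₁ r<i = ≤∧≢⇒<ᶠ (≮⇒≥ λ Pr<j → ¬dot (r , r<i , Pr<j)) (P≢ (<-trans r<i i<Qj) ∘ sym)
    ... | inj₂ r≡i rewrite toℕ-injective r≡i = j<Pi
    i<Qs : toℕ i < toℕ (Q s)
    i<Qs with m≤n⇒m<n∨m≡n s≤j
    ... | inj₁ s<j = ≤∧≢⇒<ᶠ (≮⇒≥ λ Qs<i → ¬dot (Q s , Qs<i , PQs<j)) (Q≢ (<-trans s<j j<Pi) ∘ sym)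
      where PQs<j = subst (λ x → toℕ x < toℕ j) (sym (inverseʳ π)) s<j
    ... | inj₂ s≡j rewrite toℕ-injective s≡j = i<Qj

  DotNW? : ∀ q → Dec (DotNW q)
  DotNW? (i , j) = any? λ k → (toℕ k <? toℕ i) ×-dec (toℕ (P k) <? toℕ j)

  -- Cells addressed by ℕ coordinates, so that the grid lemmas can use suc freely.
  At : (Cell n → Set) → ℕ → ℕ → Set
  At C r s = ∃ λ i → ∃ λ j → toℕ i ≡ r × toℕ j ≡ s × C (i , j)

  at : ∀ {C i j} → C (i , j) → At C (toℕ i) (toℕ j)
  at Cij = _ , _ , refl , refl , Cij

  from-at : ∀ {C i j} → At C (toℕ i) (toℕ j) → C (i , j)
  from-at (_ , _ , i≡ , j≡ , C) with toℕ-injective i≡ | toℕ-injective j≡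
  ... | refl | refl = C

  ShadowedCell : Cell n → Set
  ShadowedCell q = InRothe π q × DotNW q

  Shadowed : ℕ → ℕ → Set
  Shadowed = At ShadowedCell

  shadowed-rules : Avoids1432 π → GridRules Shadowed
  shadowed-rules avoids = record
    { S? = λ r s → any? λ i → any? λ j →
             (toℕ i ≟ r) ×-dec (toℕ j ≟ s) ×-dec InRothe? (i , j) ×-dec DotNW? (i , j)
    ; bound = n
    ; row<bound = λ { (i , _ , refl , _) → toℕ<n i }
    ; col<bound = λ { (_ , j , _ , refl , _) → toℕ<n j }
    ; nw,se⇒ne = ne ; nw,se⇒sw = sw ; ne,sw⇒nw = nw ; nw,ne,sw⇒se = se }
    where
    InRothe? : ∀ q → Dec (InRothe π q)
    InRothe? (i , j) = (toℕ j <? toℕ (P i)) ×-dec (toℕ i <? toℕ (Q j))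

    ne : ∀ {r s} → Shadowed r s → Shadowed (suc r) (suc s) → Shadowed r (suc s)
    ne (_ , _ , refl , refl , Rx , dot) (_ , _ , i+1 , j+1 , Rw , _) =
      _ , _ , refl , j+1 , UnitSquare.nw,se⇒ne i+1 j+1 Rx Rw ,
      DotNW-mono dot ≤-refl (<⇒≤ (UnitSquare.j<j′ i+1 j+1))
    sw : ∀ {r s} → Shadowed r s → Shadowed (suc r) (suc s) → Shadowed (suc r) s
    sw (_ , _ , refl , refl , Rx , dot) (_ , _ , i+1 , j+1 , Rw , _) =
      _ , _ , i+1 , refl , UnitSquare.nw,se⇒sw i+1 j+1 Rx Rw ,
      DotNW-mono dot (<⇒≤ (NextRow.i<i′ i+1)) ≤-refl
    nw : ∀ {r s} → Shadowed r (suc s) → Shadowed (suc r) s → Shadowed r s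
    nw (_ , _ , refl , j+1 , Ry , _) (_ , _ , i+1 , refl , Rz , dot) =
      _ , _ , refl , refl , Rnw , NextRow.DotNW-up i+1 (proj₁ Rnw) dot
      where Rnw = UnitSquare.ne,sw⇒nw i+1 j+1 Ry Rz
    se : ∀ {r s} → Shadowed r s → Shadowed r (suc s) → Shadowed (suc r) s → Shadowed (suc r) (suc s)
    se (_ , _ , refl , refl , _ , dot) (_ , _ , i≡ , j+1 , Ry , _) (_ , _ , i+1 , j≡ , Rz , _)
      with toℕ-injective i≡ | toℕ-injective j≡
    ... | refl | refl = _ , _ , i+1 , j+1 , UnitSquare.nw,ne,sw⇒se i+1 j+1 avoids Ry Rz dot ,
                        DotNW-mono dot (<⇒≤ (NextRow.i<i′ i+1)) (<⇒≤ (UnitSquare.j<j′ i+1 j+1))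

  Adjacent-sym : ∀ {p q : Cell n} → Adjacent p q → Adjacent q p
  Adjacent-sym (inj₁ (i≡ , inj₁ j+1)) = inj₁ (sym i≡ , inj₂ j+1)
  Adjacent-sym (inj₁ (i≡ , inj₂ j-1)) = inj₁ (sym i≡ , inj₁ j-1)
  Adjacent-sym (inj₂ (j≡ , inj₁ i+1)) = inj₂ (sym j≡ , inj₂ i+1)
  Adjacent-sym (inj₂ (j≡ , inj₂ i-1)) = inj₂ (sym j≡ , inj₁ i-1)

  Connected⇒InRothe : ∀ {p q} → Connected π p q → InRothe π q
  Connected⇒InRothe (here Rp) = Rp
  Connected⇒InRothe (step _ _ Rr) = Rr

  Connected-trans : ∀ {p q r} → Connected π p q → Connected π q r → Connected π p r
  Connected-trans p~q (here _) = p~q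
  Connected-trans p~q (step q~r adj Rs) = step (Connected-trans p~q q~r) adj Rs

  Connected-sym : ∀ {p q} → Connected π p q → Connected π q p
  Connected-sym (here Rp) = here Rp
  Connected-sym (step p~q adj Rr) =
    Connected-trans (step (here Rr) (Adjacent-sym adj) (Connected⇒InRothe p~q)) (Connected-sym p~q)

  segment-connected : (cell : Fin n → Cell n) →
    (∀ {u v} → suc (toℕ u) ≡ toℕ v → Adjacent (cell u) (cell v)) →
    ∀ {lo hi} → hi < n → (∀ w → lo ≤ toℕ w → toℕ w ≤ hi → InRothe π (cell w)) →
    ∀ {u v} → lo ≤ toℕ u → toℕ u ≤ hi → lo ≤ toℕ v → toℕ v ≤ hi → Connected π (cell u) (cell v)
  segment-connected cell adjacent {lo} {hi} hi<n inside {u} {v} lo≤u u≤hi lo≤v v≤hi =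
    spread Reached start forward backward (toℕ v) lo≤v v≤hi v refl
    where
    Reached : ℕ → Set
    Reached m = ∀ w → toℕ w ≡ m → Connected π (cell u) (cell w)
    start : Reached (toℕ u)
    start w w≡u rewrite toℕ-injective w≡u = here (inside u lo≤u u≤hi)
    forward : ∀ m → toℕ u ≤ m → m < hi → Reached m → Reached (suc m)
    forward m u≤m m<hi reached w w≡1+m =
      step (reached w′ (toℕ-fromℕ< m<n)) (adjacent (trans (cong suc (toℕ-fromℕ< m<n)) (sym w≡1+m)))
           (inside w (≤-trans lo≤u (≤-trans u≤m (≤-trans (n≤1+n m) (≤-reflexive (sym w≡1+m)))))
                     (≤-trans (≤-reflexive w≡1+m) m<hi))
      where
      m<n = <-trans m<hi hi<n
      w′ = fromℕ< m<n
    backward : ∀ m → lo ≤ m → m < toℕ u → Reached (suc m) → Reached m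
    backward m lo≤m m<u reached w w≡m =
      step (reached w′ (toℕ-fromℕ< 1+m<n))
           (Adjacent-sym (adjacent (trans (cong suc w≡m) (sym (toℕ-fromℕ< 1+m<n)))))
           (inside w (≤-trans lo≤m (≤-reflexive (sym w≡m)))
                     (≤-trans (≤-reflexive w≡m) (≤-trans (<⇒≤ m<u) u≤hi)))
      where
      1+m<n = ≤-<-trans (≤-trans m<u u≤hi) hi<n
      w′ = fromℕ< 1+m<n

  InBox : ℕ → ℕ → ℕ → ℕ → Cell n → Set
  InBox a b c d (i , j) = a ≤ toℕ i × toℕ i ≤ b × c ≤ toℕ j × toℕ j ≤ d

  box-connected : ∀ {a b c d} → b < n → d < n → (∀ q → InBox a b c d q → InRothe π q) →
    ∀ {p q} → InBox a b c d p → InBox a b c d q → Connected π p q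
  box-connected b<n d<n inside {pi , pj} {qi , qj} (a≤pi , pi≤b , c≤pj , pj≤d) (a≤qi , qi≤b , c≤qj , qj≤d) =
    Connected-trans
      (segment-connected (λ r → r , pj) (λ i+1 → inj₂ (refl , inj₁ i+1)) b<n
        (λ r a≤r r≤b → inside (r , pj) (a≤r , r≤b , c≤pj , pj≤d)) a≤pi pi≤b a≤qi qi≤b)
      (segment-connected (λ s → qi , s) (λ j+1 → inj₁ (refl , inj₁ j+1)) d<n
        (λ s c≤s s≤d → inside (qi , s) (a≤qi , qi≤b , c≤s , s≤d)) c≤pj pj≤d c≤qj qj≤d)

  connected-to-nondominant⇒DotNW : ∀ {p q} → NonDominant π p → Connected π p q → DotNW q
  connected-to-nondominant⇒DotNW {q = qi , qj} (_ , unreachable) p~q with DotNW? (qi , qj)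
  ... | yes dot = dot
  ... | no ¬dot = ⊥-elim (unreachable origin (toℕ-fromℕ< 0<n) (toℕ-fromℕ< 0<n)
                           (Connected-trans origin~q (Connected-sym p~q)))
    where
    0<n = ≤-<-trans z≤n (toℕ<n qi)
    origin = fromℕ< 0<n , fromℕ< 0<n
    origin~q : Connected π origin (qi , qj)
    origin~q = box-connected (toℕ<n qi) (toℕ<n qj)
      (λ { (r , s) (_ , r≤qi , _ , s≤qj) → dominant-quadrant (Connected⇒InRothe p~q) ¬dot r≤qi s≤qj })
      (z≤n , ≤-trans (≤-reflexive (toℕ-fromℕ< 0<n)) z≤n , z≤n , ≤-trans (≤-reflexive (toℕ-fromℕ< 0<n)) z≤n)
      (z≤n , ≤-refl , z≤n , ≤-refl)

  module _ {i j : ℕ} (B : Box Shadowed i j) where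
    open Box B

    shadowed-neighbour-in-box : ∀ {q r} → InBox a b c d q → Adjacent q r → ShadowedCell r → InBox a b c d r
    shadowed-neighbour-in-box (a≤r , r≤b , c≤s , s≤d) (inj₁ (refl , inj₁ s+1)) Sr =
      a≤r , r≤b , ≤-trans c≤s (≤-trans (n≤1+n _) (≤-reflexive s+1)) , right-stays B (sym s+1) a≤r r≤b s≤d (at Sr)
    shadowed-neighbour-in-box (a≤r , r≤b , c≤s , s≤d) (inj₁ (refl , inj₂ s-1)) Sr =
      a≤r , r≤b , left-stays B s-1 a≤r r≤b c≤s (at Sr) , ≤-trans (n≤1+n _) (≤-trans (≤-reflexive s-1) s≤d)
    shadowed-neighbour-in-box (a≤r , r≤b , c≤s , s≤d) (inj₂ (refl , inj₁ r+1)) Sr =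
      ≤-trans a≤r (≤-trans (n≤1+n _) (≤-reflexive r+1)) , below-stays B (sym r+1) r≤b c≤s s≤d (at Sr) , c≤s , s≤d
    shadowed-neighbour-in-box (a≤r , r≤b , c≤s , s≤d) (inj₂ (refl , inj₂ r-1)) Sr =
      above-stays B r-1 a≤r c≤s s≤d (at Sr) , ≤-trans (n≤1+n _) (≤-trans (≤-reflexive r-1) r≤b) , c≤s , s≤d

  InBox-cong : ∀ {a b c d a′ b′ c′ d′ q} → a ≡ a′ → b ≡ b′ → c ≡ c′ → d ≡ d′ →
    InBox a b c d q → InBox a′ b′ c′ d′ q
  InBox-cong refl refl refl refl inBox = inBox

  record RectangularComponent (p : Cell n) : Set where
    field
      a b c d : Fin n
      a≤b : toℕ a ≤ toℕ b
      c≤d : toℕ c ≤ toℕ d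
      connected⇒inBox : ∀ {q} → Connected π p q → InBox (toℕ a) (toℕ b) (toℕ c) (toℕ d) q
      inBox⇒connected : ∀ {q} → InBox (toℕ a) (toℕ b) (toℕ c) (toℕ d) q → Connected π p q

  component : Avoids1432 π → ∀ {p} → NonDominant π p → RectangularComponent p
  component avoids {i , j} nd@(Rij , _) = record
    { a = fromℕ< a<n ; b = fromℕ< b<n ; c = fromℕ< c<n ; d = fromℕ< d<n
    ; a≤b = subst₂ _≤_ (sym a≡) (sym b≡) (≤-trans a≤i i≤b)
    ; c≤d = subst₂ _≤_ (sym c≡) (sym d≡) (≤-trans c≤j j≤d)
    ; connected⇒inBox = InBox-cong (sym a≡) (sym b≡) (sym c≡) (sym d≡) ∘ sound
    ; inBox⇒connected = complete ∘ InBox-cong a≡ b≡ c≡ d≡ }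
    where
    rules = shadowed-rules avoids
    B : Box Shadowed (toℕ i) (toℕ j)
    B = box rules (at (Rij , connected-to-nondominant⇒DotNW nd (here Rij)))
    open Box B
    b<n : b < n
    b<n = GridRules.row<bound rules (filled b (toℕ j) (≤-trans a≤i i≤b) ≤-refl c≤j j≤d)
    d<n : d < n
    d<n = GridRules.col<bound rules (filled (toℕ i) d a≤i i≤b (≤-trans c≤j j≤d) ≤-refl)
    a<n = ≤-<-trans (≤-trans a≤i i≤b) b<n
    c<n = ≤-<-trans (≤-trans c≤j j≤d) d<n
    a≡ = toℕ-fromℕ< a<n
    b≡ = toℕ-fromℕ< b<n
    c≡ = toℕ-fromℕ< c<n
    d≡ = toℕ-fromℕ< d<n

    inside : ∀ q → InBox a b c d q → InRothe π q
    inside (r , s) (a≤r , r≤b , c≤s , s≤d) = proj₁ (from-at (filled _ _ a≤r r≤b c≤s s≤d))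

    sound : ∀ {q} → Connected π (i , j) q → InBox a b c d q
    sound (here _) = a≤i , i≤b , c≤j , j≤d
    sound (step p~q adj Rr) =
      shadowed-neighbour-in-box B (sound p~q) adj (Rr , connected-to-nondominant⇒DotNW nd (step p~q adj Rr))

    complete : ∀ {q} → InBox a b c d q → Connected π (i , j) q
    complete = box-connected b<n d<n inside (a≤i , i≤b , c≤j , j≤d)

  component-is-rectangle : Avoids1432 π → ∀ {p} → NonDominant π p → ComponentIsRectangle π p
  component-is-rectangle avoids nd = a , b , c , d , a≤b , c≤d , λ q → connected⇒inBox , inBox⇒connected
    where open RectangularComponent (component avoids nd)

  module _ {e : Cell n} (C : RectangularComponent e) where
    open RectangularComponent C

    essential-on-bottom : Essential π e → toℕ (row e) ≡ toℕ b
    essential-on-bottom (Re , ¬Rbelow , _) with connected⇒inBox (here Re)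
    ... | a≤x , x≤b , c≤y , y≤d with m≤n⇒m<n∨m≡n x≤b
    ...   | inj₂ x≡b = x≡b
    ...   | inj₁ x<b = ⊥-elim (¬Rbelow x′ (toℕ-fromℕ< 1+x<n) (Connected⇒InRothe (inBox⇒connected
              (≤-trans a≤x (≤-trans (n≤1+n _) (≤-reflexive (sym (toℕ-fromℕ< 1+x<n)))) ,
               ≤-trans (≤-reflexive (toℕ-fromℕ< 1+x<n)) x<b , c≤y , y≤d))))
      where
      1+x<n = ≤-<-trans x<b (toℕ<n b)
      x′ = fromℕ< 1+x<n

  bottom-not-above : Avoids1432 π → ∀ {e₁ e₂ q₁ q₂} →
    (C₁ : RectangularComponent e₁) (C₂ : RectangularComponent e₂) → NonDominant π e₂ → Essential π e₁ → Connected π e₁ q₁ → Connected π e₂ q₂ → row q₁ ≡ row q₂ →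
    ¬ toℕ (RectangularComponent.b C₁) < toℕ (RectangularComponent.b C₂)
  bottom-not-above avoids {e₁} {e₂} {q₁} {q₂} C₁ C₂ nd₂ ess₁@(Re₁ , ¬Rbelow , _) e₁~q₁ e₂~q₂ q-row b₁<b₂ =
    NextRow.row-under-bottom-edge-dominant z+1 avoids Re₁ (¬Rbelow (row z) z+1)
      (Connected⇒InRothe e₂~z) (connected-to-nondominant⇒DotNW nd₂ e₂~z)
    where
    module C₁ = RectangularComponent C₁
    module C₂ = RectangularComponent C₂
    1+b₁<n = ≤-<-trans b₁<b₂ (toℕ<n C₂.b)
    z = fromℕ< 1+b₁<n , C₂.c
    z+1 : toℕ (row z) ≡ suc (toℕ (row e₁))
    z+1 = trans (toℕ-fromℕ< 1+b₁<n) (cong suc (sym (essential-on-bottom C₁ ess₁)))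
    a₂≤z : toℕ C₂.a ≤ toℕ (row z)
    a₂≤z = begin
      toℕ C₂.a        ≤⟨ proj₁ (C₂.connected⇒inBox e₂~q₂) ⟩
      toℕ (row q₂)    ≡⟨ cong toℕ (sym q-row) ⟩
      toℕ (row q₁)    ≤⟨ proj₁ (proj₂ (C₁.connected⇒inBox e₁~q₁)) ⟩
      toℕ C₁.b        <⟨ n<1+n _ ⟩
      suc (toℕ C₁.b)  ≡⟨ toℕ-fromℕ< 1+b₁<n ⟨
      toℕ (row z)     ∎
      where open ≤-Reasoning
    e₂~z : Connected π e₂ z
    e₂~z = C₂.inBox⇒connected (a₂≤z , ≤-trans (≤-reflexive (toℕ-fromℕ< 1+b₁<n)) b₁<b₂ , ≤-refl , C₂.c≤d)

  same-bottom-row : Avoids1432 π → ∀ {e₁ e₂ q₁ q₂} →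
    (C₁ : RectangularComponent e₁) (C₂ : RectangularComponent e₂) → NonDominant π e₁ → NonDominant π e₂ →
    Essential π e₁ → Essential π e₂ → Connected π e₁ q₁ → Connected π e₂ q₂ →
    row q₁ ≡ row q₂ → row e₁ ≡ row e₂
  same-bottom-row avoids C₁ C₂ nd₁ nd₂ ess₁ ess₂ e₁~q₁ e₂~q₂ q-row
    with <-cmp (toℕ (RectangularComponent.b C₁)) (toℕ (RectangularComponent.b C₂))
  ... | tri< b₁<b₂ _ _ = ⊥-elim (bottom-not-above avoids C₁ C₂ nd₂ ess₁ e₁~q₁ e₂~q₂ q-row b₁<b₂)
  ... | tri> _ _ b₂<b₁ = ⊥-elim (bottom-not-above avoids C₂ C₁ nd₁ ess₂ e₂~q₂ e₁~q₁ (sym q-row) b₂<b₁)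
  ... | tri≈ _ b₁≡b₂ _ =
    toℕ-injective (trans (essential-on-bottom C₁ ess₁) (trans b₁≡b₂ (sym (essential-on-bottom C₂ ess₂))))

  same-row : Avoids1432 π → ∀ {e₁ e₂ q₁ q₂} → NonDominant π e₁ → NonDominant π e₂ →
    Essential π e₁ → Essential π e₂ → Connected π e₁ q₁ → Connected π e₂ q₂ →
    row q₁ ≡ row q₂ → row e₁ ≡ row e₂
  same-row avoids nd₁ nd₂ = same-bottom-row avoids (component avoids nd₁) (component avoids nd₂) nd₁ nd₂

module _ {n : ℕ} where

  Adjacent-transpose : ∀ {p q : Cell n} → Adjacent p q → Adjacent (swap p) (swap q)
  Adjacent-transpose (inj₁ same-row) = inj₂ same-row
  Adjacent-transpose (inj₂ same-col) = inj₁ same-col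

  Connected-transpose : ∀ {π : Permutation′ n} {p q} → Connected π p q → Connected (flip π) (swap p) (swap q)
  Connected-transpose (here Rp) = here (swap Rp)
  Connected-transpose (step p~q adj Rr) = step (Connected-transpose p~q) (Adjacent-transpose adj) (swap Rr)

  NonDominant-transpose : ∀ {π : Permutation′ n} {p} → NonDominant π p → NonDominant (flip π) (swap p)
  NonDominant-transpose (Rp , unreachable) =
    swap Rp , λ o o-row o-col o~p → unreachable (swap o) o-col o-row (Connected-transpose o~p)

  Essential-transpose : ∀ {π : Permutation′ n} {e} → Essential π e → Essential (flip π) (swap e)
  Essential-transpose (Re , ¬Rbelow , ¬Rright) =
    swap Re , (λ j′ j+1 → ¬Rright j′ j+1 ∘ swap) , (λ i′ i+1 → ¬Rbelow i′ i+1 ∘ swap)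

  Avoids1432-transpose : ∀ {π : Permutation′ n} → Avoids1432 π → Avoids1432 (flip π)
  Avoids1432-transpose {π} avoids (a , b , c , d , a<b , b<c , c<d , Qa<Qd , Qd<Qc , Qc<Qb) =
    avoids (_ , _ , _ , _ , Qa<Qd , Qd<Qc , Qc<Qb , P∘Q-< a<b , P∘Q-< b<c , P∘Q-< c<d)
    where
    P∘Q-< : ∀ {j l} → toℕ j < toℕ l → toℕ (π ⟨$⟩ʳ (π ⟨$⟩ˡ j)) < toℕ (π ⟨$⟩ʳ (π ⟨$⟩ˡ l))
    P∘Q-< = subst₂ (λ x y → toℕ x < toℕ y) (sym (inverseʳ π)) (sym (inverseʳ π))

lemma5p17 : (n : ℕ) → (π : Permutation′ n) → Avoids1432 π →
    ((p : Cell n) → NonDominant π p → ComponentIsRectangle π p) ×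
    ((e₁ e₂ : Cell n) →
      NonDominant π e₁ → NonDominant π e₂ →
      ¬ Connected π e₁ e₂ →
      Essential π e₁ → Essential π e₂ →
      ((q₁ q₂ : Cell n) → Connected π e₁ q₁ → Connected π e₂ q₂ →
        row q₁ ≡ row q₂ → row e₁ ≡ row e₂) ×
      ((q₁ q₂ : Cell n) → Connected π e₁ q₁ → Connected π e₂ q₂ →
        col q₁ ≡ col q₂ → col e₁ ≡ col e₂))
lemma5p17 n π avoids =
  (λ p → Rothe.component-is-rectangle π avoids) ,
  -- Part (b) does not need the two components to be distinct.
  λ e₁ e₂ nd₁ nd₂ _ ess₁ ess₂ →
    (λ q₁ q₂ → Rothe.same-row π avoids nd₁ nd₂ ess₁ ess₂) ,
    (λ q₁ q₂ e₁~q₁ e₂~q₂ →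
       Rothe.same-row (flip π) (Avoids1432-transpose {π = π} avoids)
         (NonDominant-transpose nd₁) (NonDominant-transpose nd₂)
         (Essential-transpose {π = π} ess₁) (Essential-transpose {π = π} ess₂)
         (Connected-transpose e₁~q₁) (Connected-transpose e₂~q₂))
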